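{- There exists a family of instances $(G_i,\mathcal{T}_i,d_i)_{i\in\mathbb{N}}$ of Generalized Steiner Tree Packing such that $\{\mathrm{vc}((G_i)^{\mathcal{T}_i}_{\mathrm{clique}})\}_{i\in\mathbb{N}}$ is bounded while $\{\mathrm{vc}((G_i)^{\mathcal{T}_i}_{\mathrm{vert}})\}_{i\in\mathbb{N}}$ is unbounded, where $\mathrm{vc}$ denotes the vertex cover number.
   Context: An instance of Generalized Steiner Tree Packing is a triple $(G,\mathcal{T},d)$ where $G$ is a simple undirected graph, $\mathcal{T}\subseteq 2^{V(G)}$ is a set of terminal sets and $d\colon\mathcal{T}\to\mathbb{N}^+$. The clique-augmented graph $G^{\mathcal{T}}_{\mathrm{clique}}$ is the multigraph obtained from $G$ by adding, for every $T\in\mathcal{T}$ and every pair of distinct $u,v\in T$, a new edge $uv$ (possibly parallel to existing ones). The vertex-augmented graph $G^{\mathcal{T}}_{\mathrm{vert}}$ is obtained from $G$ by adding, for every $T\in\mathcal{T}$, a new vertex adjacent to exactly the vertices of $T$. The vertex cover number is the minimum size of a set $S$ of vertices such that every edge has an endpoint in $S$. -}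

module Defs where

open import Data.Nat using (ℕ; zero; suc; _+_; _≤_; _<_)
open import Data.Bool using (Bool; true; false; if_then_else_; _∧_)
open import Data.Fin using (Fin; splitAt; _≟_)
open import Data.Fin.Subset using (Subset; _∈_; ∣_∣)
open import Data.Fin.Subset.Properties using (_∈?_)
open import Data.Vec using (lookup)
open import Data.Sum using (_⊎_; inj₁; inj₂)
open import Data.Product using (Σ; _×_; _,_)
open import Relation.Nullary using (¬_; does)
open import Relation.Binary.PropositionalEquality using (_≡_)
open import Function.Definitions using (Injective)

record SimpleGraph (n : ℕ) : Set where
  field
    adj    : Fin n → Fin n → Bool
    sym    : ∀ u v → adj u v ≡ adj v u
    irrefl : ∀ v → adj v v ≡ false

open SimpleGraph public

-- Instances (G, 𝒯, d) of Generalized Steiner Tree Packing.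
-- 𝒯 is a set of m distinct terminal sets T₀,…,T_{m-1} ⊆ V(G)
-- (given by an injective indexing), and d : 𝒯 → ℕ⁺.

record GSTPInstance : Set where
  field
    n     : ℕ
    G     : SimpleGraph n
    m     : ℕ
    T     : Fin m → Subset n
    T-inj : Injective _≡_ _≡_ T
    d     : Fin m → ℕ
    d-pos : ∀ t → 1 ≤ d t

open GSTPInstance public

-- Loopless undirected multigraphs on Fin V, given by an edge-multiplicity
-- function (mult u v = number of parallel edges between u and v).

record Multigraph : Set where
  field
    V    : ℕ
    mult : Fin V → Fin V → ℕ

open Multigraph public

b2n : Bool → ℕ
b2n true  = 1
b2n false = 0

countBoth : ∀ {n} m → (Fin m → Subset n) → Fin n → Fin n → ℕ
countBoth zero    T u v = 0
countBoth (suc m) T u v =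
  b2n (lookup (T Fin.zero) u ∧ lookup (T Fin.zero) v)
    + countBoth m (λ t → T (Fin.suc t)) u v

cliqueAug : GSTPInstance → Multigraph
cliqueAug I = record
  { V    = n I
  ; mult = λ u v → if does (u ≟ v) then 0
                   else b2n (adj (G I) u v) + countBoth (m I) (T I) u v
  }

-- Vertex-augmented graph G^𝒯_vert on vertex set V(G) ⊎ 𝒯 (encoded as
-- Fin (n + m) via splitAt): a new vertex for each T ∈ 𝒯, adjacent exactly
-- to the vertices of T.
vertAug : GSTPInstance → Multigraph
vertAug I = record
  { V    = n I + m I
  ; mult = λ x y → go (splitAt (n I) x) (splitAt (n I) y)
  }
  where
  go : Fin (n I) ⊎ Fin (m I) → Fin (n I) ⊎ Fin (m I) → ℕ
  go (inj₁ u) (inj₁ v) = b2n (adj (G I) u v)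
  go (inj₁ u) (inj₂ t) = b2n (lookup (T I t) u)
  go (inj₂ t) (inj₁ u) = b2n (lookup (T I t) u)
  go (inj₂ s) (inj₂ t) = 0

IsVertexCover : (H : Multigraph) → Subset (V H) → Set
IsVertexCover H S = ∀ u v → 0 < mult H u v → (u ∈ S) ⊎ (v ∈ S)

-- vc H ≡ k, stated relationally: k is the minimum size of a vertex cover.
IsVCNumber : Multigraph → ℕ → Set
IsVCNumber H k =
  Σ (Subset (V H)) (λ S → IsVertexCover H S × ∣ S ∣ ≡ k)
  × (∀ S → IsVertexCover H S → k ≤ ∣ S ∣)

{-# OPTIONS --safe #-}
module Submission where

-- Take the edgeless graph on n vertices with the n singleton terminal sets.
-- A singleton contains no pair of distinct vertices, so the clique-augmented
-- graph has no edges at all and its vertex cover number is 0.  In the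
-- vertex-augmented graph every vertex v is joined to the new vertex of {v}:
-- these n edges form a matching, so every vertex cover has at least n
-- vertices, and the n original vertices cover.

open import Defs hiding (sym)
open import Data.Nat using (ℕ; zero; suc; _+_; _≤_; _<_; z≤n; s≤s)
open import Data.Nat.Properties
  using (≤-refl; ≤-trans; ≤-reflexive; +-suc; +-monoʳ-≤; +-identityʳ; n≤0⇒n≡0; module ≤-Reasoning)
open import Data.Bool using (true; false; _∧_)
open import Data.Fin as Fin using (Fin; _↑ˡ_; _↑ʳ_; _≟_)
open import Data.Fin.Properties using (splitAt-↑ˡ; splitAt-↑ʳ; splitAt⁻¹-↑ˡ)
open import Data.Fin.Subset
  using (Subset; inside; outside; _∈_; _⊆_; _∪_; ⊤; ⊥; ⁅_⁆; ∣_∣)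
open import Data.Fin.Subset.Properties
  using (∈⊤; x∈⁅x⁆; x∈⁅y⁆⇒x≡y; ∣⊤∣≡n; ∣⊥∣≡0; ∣p∣≤∣x∷p∣; p⊆q⇒∣p∣≤∣q∣; x∈p∪q⁺)
open import Data.Vec using ([]; _∷_; lookup; _++_)
import Data.Vec as Vec
open import Data.Vec.Properties using (lookup-++ˡ; lookup-++ʳ; []=⇒lookup; lookup⇒[]=)
open import Data.Sum as Sum using (_⊎_; inj₁; inj₂)
open import Data.Product using (Σ; _×_; _,_)
open import Relation.Nullary using (yes; no; contradiction)
open import Relation.Binary.PropositionalEquality
  using (_≡_; _≢_; refl; sym; trans; cong; cong₂; subst; module ≡-Reasoning)

∣p++q∣≡∣p∣+∣q∣ : ∀ {m n} (p : Subset m) (q : Subset n) → ∣ p ++ q ∣ ≡ ∣ p ∣ + ∣ q ∣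
∣p++q∣≡∣p∣+∣q∣ []            q = refl
∣p++q∣≡∣p∣+∣q∣ (inside  ∷ p) q = cong suc (∣p++q∣≡∣p∣+∣q∣ p q)
∣p++q∣≡∣p∣+∣q∣ (outside ∷ p) q = ∣p++q∣≡∣p∣+∣q∣ p q

∣p∪q∣≤∣p∣+∣q∣ : ∀ {n} (p q : Subset n) → ∣ p ∪ q ∣ ≤ ∣ p ∣ + ∣ q ∣
∣p∪q∣≤∣p∣+∣q∣ []            []            = z≤n
∣p∪q∣≤∣p∣+∣q∣ (inside  ∷ p) (s ∷ q)       =
  s≤s (≤-trans (∣p∪q∣≤∣p∣+∣q∣ p q) (+-monoʳ-≤ ∣ p ∣ (∣p∣≤∣x∷p∣ s q)))
∣p∪q∣≤∣p∣+∣q∣ (outside ∷ p) (inside  ∷ q) =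
  ≤-trans (s≤s (∣p∪q∣≤∣p∣+∣q∣ p q)) (≤-reflexive (sym (+-suc ∣ p ∣ ∣ q ∣)))
∣p∪q∣≤∣p∣+∣q∣ (outside ∷ p) (outside ∷ q) = ∣p∪q∣≤∣p∣+∣q∣ p q

module _ {m n} (p : Subset m) (q : Subset n) where

  ∈-++⁺ˡ : ∀ {i} → i ∈ p → i ↑ˡ n ∈ p ++ q
  ∈-++⁺ˡ {i} i∈p = lookup⇒[]= (i ↑ˡ n) (p ++ q) (trans (lookup-++ˡ p q i) ([]=⇒lookup i∈p))

  ∈-++⁻ˡ : ∀ {i} → i ↑ˡ n ∈ p ++ q → i ∈ p
  ∈-++⁻ˡ {i} i∈pq = lookup⇒[]= i p (trans (sym (lookup-++ˡ p q i)) ([]=⇒lookup i∈pq))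

  ∈-++⁻ʳ : ∀ {i} → m ↑ʳ i ∈ p ++ q → i ∈ q
  ∈-++⁻ʳ {i} i∈pq = lookup⇒[]= i q (trans (sym (lookup-++ʳ p q i)) ([]=⇒lookup i∈pq))

matching⇒n≤∣S∣ : ∀ {n} (S : Subset (n + n)) → (∀ j → j ↑ˡ n ∈ S ⊎ n ↑ʳ j ∈ S) → n ≤ ∣ S ∣
matching⇒n≤∣S∣ {n} S covers with Vec.splitAt n S
... | p , q , refl = begin
  n             ≡⟨ sym (∣⊤∣≡n n) ⟩
  ∣ ⊤ {n} ∣     ≤⟨ p⊆q⇒∣p∣≤∣q∣ ⊤⊆p∪q ⟩
  ∣ p ∪ q ∣     ≤⟨ ∣p∪q∣≤∣p∣+∣q∣ p q ⟩
  ∣ p ∣ + ∣ q ∣ ≡⟨ sym (∣p++q∣≡∣p∣+∣q∣ p q) ⟩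
  ∣ p ++ q ∣    ∎
  where
  open ≤-Reasoning
  ⊤⊆p∪q : ⊤ ⊆ p ∪ q
  ⊤⊆p∪q {j} _ = x∈p∪q⁺ (Sum.map (∈-++⁻ˡ p q) (∈-++⁻ʳ p q) (covers j))

⁅⁆-injective : ∀ {n} {x y : Fin n} → ⁅ x ⁆ ≡ ⁅ y ⁆ → x ≡ y
⁅⁆-injective {x = x} {y} eq = x∈⁅y⁆⇒x≡y y (subst (x ∈_) eq (x∈⁅x⁆ x))

⁅⁆-pairFree : ∀ {n} (t : Fin n) {u v} → u ≢ v → (lookup ⁅ t ⁆ u ∧ lookup ⁅ t ⁆ v) ≡ false
⁅⁆-pairFree t {u} {v} u≢v with lookup ⁅ t ⁆ u in u∈t | lookup ⁅ t ⁆ v in v∈t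
... | false | _     = refl
... | true  | false = refl
... | true  | true  = contradiction (trans (≡t u u∈t) (sym (≡t v v∈t))) u≢v
  where
  ≡t : ∀ w → lookup ⁅ t ⁆ w ≡ true → w ≡ t
  ≡t w w∈t = x∈⁅y⁆⇒x≡y t (lookup⇒[]= w ⁅ t ⁆ w∈t)

countBoth≡0 : ∀ {n} m (T : Fin m → Subset n) {u v} →
              (∀ t → (lookup (T t) u ∧ lookup (T t) v) ≡ false) →
              countBoth m T u v ≡ 0
countBoth≡0 zero    T none = refl
countBoth≡0 (suc m) T none rewrite none Fin.zero =
  countBoth≡0 m (λ t → T (Fin.suc t)) (λ t → none (Fin.suc t))

cliqueAug-edgeless : ∀ I → (∀ u v → adj (G I) u v ≡ false) →
                     (∀ t {u v} → u ≢ v → (lookup (T I t) u ∧ lookup (T I t) v) ≡ false) →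
                     ∀ u v → mult (cliqueAug I) u v ≡ 0
cliqueAug-edgeless I noEdge pairFree u v with u ≟ v
... | yes _   = refl
... | no  u≢v rewrite noEdge u v = countBoth≡0 (m I) (T I) (λ t → pairFree t u≢v)

vertAug-terminalEdge : ∀ I {u t} → u ∈ T I t → 0 < mult (vertAug I) (u ↑ˡ m I) (n I ↑ʳ t)
vertAug-terminalEdge I {u} {t} u∈t
  rewrite splitAt-↑ˡ (n I) u (m I) | splitAt-↑ʳ (n I) (m I) t | []=⇒lookup u∈t = s≤s z≤n

originalVertices : ∀ I → Subset (n I + m I)
originalVertices I = ⊤ {n I} ++ ⊥ {m I}

∣originalVertices∣≡n : ∀ I → ∣ originalVertices I ∣ ≡ n I
∣originalVertices∣≡n I = begin
  ∣ ⊤ {n I} ++ ⊥ {m I} ∣    ≡⟨ ∣p++q∣≡∣p∣+∣q∣ (⊤ {n I}) ⊥ ⟩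
  ∣ ⊤ {n I} ∣ + ∣ ⊥ {m I} ∣ ≡⟨ cong₂ _+_ (∣⊤∣≡n (n I)) (∣⊥∣≡0 (m I)) ⟩
  n I + 0                   ≡⟨ +-identityʳ (n I) ⟩
  n I                       ∎
  where open ≡-Reasoning

∈originalVertices : ∀ I {x u} → Fin.splitAt (n I) x ≡ inj₁ u → x ∈ originalVertices I
∈originalVertices I x≡u = subst (_∈ originalVertices I) (splitAt⁻¹-↑ˡ x≡u) (∈-++⁺ˡ ⊤ (⊥ {m I}) ∈⊤)

originalVertices-cover : ∀ I → IsVertexCover (vertAug I) (originalVertices I)
originalVertices-cover I x y edge with Fin.splitAt (n I) x in x≡u | Fin.splitAt (n I) y in y≡v
... | inj₁ _ | _      = inj₁ (∈originalVertices I x≡u)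
... | inj₂ _ | inj₁ _ = inj₂ (∈originalVertices I y≡v)
... | inj₂ _ | inj₂ _ with edge
... | ()

edgeless⇒vc≡0 : ∀ H {k} → (∀ u v → mult H u v ≡ 0) → IsVCNumber H k → k ≡ 0
edgeless⇒vc≡0 H {k} noEdge (_ , minimal) =
  n≤0⇒n≡0 (subst (k ≤_) (∣⊥∣≡0 (V H)) (minimal ⊥ ⊥-cover))
  where
  ⊥-cover : IsVertexCover H ⊥
  ⊥-cover u v edge with () ← subst (0 <_) (noEdge u v) edge

emptyGraph : ∀ n → SimpleGraph n
emptyGraph n = record { adj = λ _ _ → false ; sym = λ _ _ → refl ; irrefl = λ _ → refl }

singletonInstance : ℕ → GSTPInstance
singletonInstance n = record
  { n = n ; G = emptyGraph n ; m = n ; T = ⁅_⁆ ; T-inj = ⁅⁆-injective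
  ; d = λ _ → 1 ; d-pos = λ _ → s≤s z≤n }

cliqueAug-singletonInstance-vc≡0 : ∀ n {k} → IsVCNumber (cliqueAug (singletonInstance n)) k → k ≡ 0
cliqueAug-singletonInstance-vc≡0 n =
  edgeless⇒vc≡0 _ (cliqueAug-edgeless (singletonInstance n) (λ _ _ → refl) ⁅⁆-pairFree)

vertAug-singletonInstance-vc≡n : ∀ n → IsVCNumber (vertAug (singletonInstance n)) n
vertAug-singletonInstance-vc≡n n =
  (originalVertices I , originalVertices-cover I , ∣originalVertices∣≡n I) ,
  λ S cover → matching⇒n≤∣S∣ S (λ j → cover _ _ (vertAug-terminalEdge I (x∈⁅x⁆ j)))
  where I = singletonInstance n

lemma3p2 : Σ (ℕ → GSTPInstance) (λ I →
             Σ ℕ (λ B → ∀ i k → IsVCNumber (cliqueAug (I i)) k → k ≤ B)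
             × (∀ B → Σ ℕ (λ i → Σ ℕ (λ k → IsVCNumber (vertAug (I i)) k × B < k))))
lemma3p2 = singletonInstance
  , (0 , λ i k vc → ≤-reflexive (cliqueAug-singletonInstance-vc≡0 i vc))
  , λ B → suc B , suc B , vertAug-singletonInstance-vc≡n (suc B) , ≤-refl
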